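{- Let $G$ be a finite group with identity $1$, and let $G_2=\{a\in G : a^2=1\}$. Let $\Gamma=(V,E)$ be a weakly connected directed graph (loops and multiple edges allowed), and let $\Gamma'$ be its underlying undirected graph. Let $\mathcal{FU}(V\cup\mathbb E,G)$ denote the set of all balanced functions $h:V\cup\mathbb E\to G$ (in the sense described in the context). Then: (1) if $\Gamma'$ is bipartite, then $|\mathcal{FU}(V\cup\mathbb E,G)|=|G|^{|V|}$; (2) if $\Gamma'$ is not bipartite, then $|\mathcal{FU}(V\cup\mathbb E,G)|=|G_2|\cdot|G|^{|V|-1}$.
   Context: A directed graph is weakly connected if its underlying undirected graph is connected. For each edge $e\in E$ going from $v$ to $w$, let $\bar e$ denote the same edge traversed in the opposite direction (from $w$ to $v$), and let $\mathbb E=\{e,\bar e : e\in E\}$. A path from a vertex $x$ to a vertex $y$ is an alternating sequence $v_1,e_1,v_2,e_2,\dots,v_n,e_n$ of vertices from $V$ and pairwise different elements of $\mathbb E$ such that $v_1=x$, each $e_j$ ($j=1,\dots,n-1$) goes from $v_j$ to $v_{j+1}$, and $e_n$ goes from $v_n$ to $y$ (so an edge $e$ may appear once as $e$ and once as $\bar e$). A cycle is a path from a vertex to itself; the empty (trivial) cycle is also allowed. A function $h:V\cup\mathbb E\to G$ is called balanced if $h(\bar e)=(h(e))^{ -1}$ for all $e\in E$ and for every cycle $v_1,e_1,\dots,v_n,e_n$ of $\Gamma$ one has $h(v_1)\cdot h(e_1)\cdot h(v_2)\cdot h(e_2)\cdots h(v_n)\cdot h(e_n)=1$. -}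

module Defs where

open import Level using (Level; _⊔_; 0ℓ)
open import Data.Nat using (ℕ)
open import Data.Fin using (Fin)
open import Data.Bool using (Bool)
open import Data.Sum using (_⊎_; inj₁; inj₂)
open import Data.Product using (Σ; ∃; _×_; _,_; proj₁; proj₂)
open import Data.List using (List; []; _∷_; map; foldr)
open import Data.List.Relation.Unary.Unique.Propositional using (Unique)
open import Relation.Binary.Bundles using (Setoid)
open import Relation.Binary.PropositionalEquality as ≡ using (_≡_; _≢_)
open import Function.Bundles using (Func; Bijection)
open import Algebra.Bundles using (Group)

record Digraph (n m : ℕ) : Set where
  field
    src tgt : Fin m → Fin n

-- Elements of 𝔼 = {e, ē : e ∈ E}
data Dart (m : ℕ) : Set where
  fwd : Fin m → Dart m
  bwd : Fin m → Dart m

module _ {n m : ℕ} (Γ : Digraph n m) where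
  open Digraph Γ

  dfrom dto : Dart m → Fin n
  dfrom (fwd e) = src e
  dfrom (bwd e) = tgt e
  dto (fwd e) = tgt e
  dto (bwd e) = src e

  IsWalk : Fin n → Fin n → List (Fin n × Dart m) → Set
  IsWalk x y [] = x ≡ y
  IsWalk x y ((v , d) ∷ rest) = (v ≡ x) × (dfrom d ≡ v) × IsWalk (dto d) y rest

  IsPath : Fin n → Fin n → List (Fin n × Dart m) → Set
  IsPath x y ps = IsWalk x y ps × Unique (map proj₂ ps)

  IsCycle : Fin n → List (Fin n × Dart m) → Set
  IsCycle x ps = IsPath x x ps

  WeaklyConnected : Set
  WeaklyConnected = (u v : Fin n) → ∃ λ ps → IsWalk u v ps

  Bipartite : Set
  Bipartite = ∃ λ (c : Fin n → Bool) → (e : Fin m) → c (src e) ≢ c (tgt e)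

  module _ {c ℓ : Level} (G : Group c ℓ) where
    open Group G

    Fun : Set c
    Fun = Fin n ⊎ Dart m → Carrier

    cycleProduct : Fun → List (Fin n × Dart m) → Carrier
    cycleProduct h = foldr (λ p acc → h (inj₁ (proj₁ p)) ∙ (h (inj₂ (proj₂ p)) ∙ acc)) ε

    Balanced : Fun → Set ℓ
    Balanced h = ((e : Fin m) → h (inj₂ (bwd e)) ≈ (h (inj₂ (fwd e))) ⁻¹)
               × ((x : Fin n) (ps : List (Fin n × Dart m)) → IsCycle x ps → cycleProduct h ps ≈ ε)

    FU : Setoid (c ⊔ ℓ) ℓ
    FU = record
      { Carrier = Σ Fun Balanced
      ; _≈_ = λ h k → (z : Fin n ⊎ Dart m) → proj₁ h z ≈ proj₁ k z
      ; isEquivalence = record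
        { refl = λ z → refl
        ; sym = λ p z → sym (p z)
        ; trans = λ p q z → trans (p z) (q z) } }

HasCard : {a ℓ : Level} → Setoid a ℓ → ℕ → Set (a ⊔ ℓ)
HasCard S k = Bijection S (≡.setoid (Fin k))

module _ {c ℓ : Level} (G : Group c ℓ) where
  open Group G

  G₂ : Setoid (c ⊔ ℓ) ℓ
  G₂ = record
    { Carrier = Σ Carrier (λ a → a ∙ a ≈ ε)
    ; _≈_ = λ a b → proj₁ a ≈ proj₁ b
    ; isEquivalence = record { refl = refl ; sym = sym ; trans = trans } }

-- Fix a root r. For a balanced h the product of h along a walk depends only on its endpoints:
-- balance kills the products along cycles, and a closed walk that repeats a dart splits into
-- two shorter closed walks. So the potential P(v), the product along any walk from r to v, is
-- well defined, P(r) = 1, and h(v)·h(d) = P(v)⁻¹·P(w) for every dart d from v to w. Writing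
-- h(v) = P(v)⁻¹·z(v)·P(v) then forces h(d) = P(v)⁻¹·z(v)⁻¹·P(w), and h(ē) = h(e)⁻¹ becomes
-- z(w) = z(v)⁻¹ along every edge. Conversely these formulas turn any such alternating z and any
-- P with P(r) = 1 into a balanced function, so |FU| = |{alternating z}|·|G|^(|V|-1).
-- On a connected graph an alternating z is determined by z(r): on a bipartite graph z(r) is
-- arbitrary, while if z(r) ≠ z(r)⁻¹ the values of z 2-colour the graph, so on a non-bipartite
-- graph z(r) ranges over G₂.

module Submission where

open import Defs
open import Level using (Level; _⊔_)
open import Data.Nat using (ℕ; zero; suc; _+_; _^_; _*_; _∸_; _<_; s≤s; z≤n)
open import Data.Nat.Properties using (m<m+n; m<n+m; m≤n+m; +-monoʳ-<; module ≤-Reasoning)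
open import Data.Nat.Induction using (<-wellFounded)
open import Induction.WellFounded using (Acc; acc)
open import Data.Fin using (Fin; zero; suc)
open import Data.Fin.Properties using (*↔×; ¬Fin0) renaming (_≟_ to _≟ᶠ_)
open import Data.Bool using (Bool; true; false; not)
open import Data.Bool.Properties using (¬-not)
open import Data.Empty using (⊥-elim)
open import Data.Sum using (_⊎_; inj₁; inj₂)
open import Data.Product using (Σ; ∃; _×_; _,_; proj₁; proj₂)
open import Data.Product.Relation.Binary.Pointwise.NonDependent using (_×ₛ_; Pointwise-≡↔≡)
open import Data.Product.Function.NonDependent.Setoid using (_×-inverse_)
open import Data.List using (List; []; _∷_; _++_; [_]; map; length)
open import Data.List.Properties using (length-++)
open import Data.List.Relation.Unary.Any using (Any; here; there; any?)
open import Data.List.Relation.Unary.All.Properties using (¬Any⇒All¬)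
open import Data.List.Relation.Unary.AllPairs using ([]; _∷_)
open import Data.List.Relation.Unary.Unique.Propositional using (Unique)
open import Data.Vec.Functional using (tail)
open import Data.Vec.Functional.Relation.Binary.Equality.Setoid using (≋-setoid)
open import Relation.Nullary using (¬_; yes; no; does; contradiction)
open import Relation.Nullary.Decidable using (map′; decidable-stable)
open import Relation.Binary.Definitions using (Decidable; DecidableEquality)
open import Relation.Binary.PropositionalEquality as ≡ using (_≡_; _≢_)
open import Relation.Binary.Bundles using (Setoid)
import Relation.Binary.Construct.On as On
open import Function.Base using (_∘_)
open import Function.Bundles using (Bijection; Inverse)
open import Function.Definitions using (Congruent; StrictlyInverseˡ; StrictlyInverseʳ)
open import Function.Consequences.Setoid using (strictlyInverseˡ⇒inverseˡ; strictlyInverseʳ⇒inverseʳ)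
open import Function.Properties.Bijection using (Bijection⇒Inverse)
open import Function.Properties.Inverse using (Inverse⇒Bijection)
import Function.Properties.Inverse as Inverse
open import Algebra.Bundles using (Group)

module _ {a b ℓa ℓb : Level} {S : Setoid a ℓa} {T : Setoid b ℓb} where
  private
    module S = Setoid S
    module T = Setoid T

  mkInverse : (to : S.Carrier → T.Carrier) (from : T.Carrier → S.Carrier) →
              Congruent S._≈_ T._≈_ to → Congruent T._≈_ S._≈_ from →
              StrictlyInverseˡ T._≈_ to from → StrictlyInverseʳ S._≈_ to from →
              Inverse S T
  mkInverse to from to-cong from-cong to∘from from∘to = record
    { to = to
    ; from = from
    ; to-cong = to-cong
    ; from-cong = from-cong
    ; inverse = strictlyInverseˡ⇒inverseˡ S T to-cong to∘from
              , strictlyInverseʳ⇒inverseʳ S T from-cong from∘to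
    }

  hasCard-↔ : {k : ℕ} → Inverse S T → HasCard T k → HasCard S k
  hasCard-↔ S↔T T≅k = Inverse⇒Bijection (Inverse.trans S↔T (Bijection⇒Inverse T≅k))

  hasCard-× : {i j : ℕ} → HasCard S i → HasCard T j → HasCard (S ×ₛ T) (i * j)
  hasCard-× S≅i T≅j = Inverse⇒Bijection
    (Inverse.trans (Bijection⇒Inverse S≅i ×-inverse Bijection⇒Inverse T≅j)
      (Inverse.trans Pointwise-≡↔≡ (Inverse.sym *↔×)))

module _ {a ℓa : Level} (S : Setoid a ℓa) where
  open Setoid S

  hasCard-1 : Carrier → (∀ x y → x ≈ y) → HasCard S 1
  hasCard-1 x all≈ = record
    { to = λ _ → zero
    ; cong = λ _ → ≡.refl
    ; bijective = (λ {y} {z} _ → all≈ y z) , λ { zero → x , λ _ → ≡.refl }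
    }

  hasCard⇒decidable : {k : ℕ} → HasCard S k → Decidable _≈_
  hasCard⇒decidable S≅k x y = map′ injective cong (to x ≟ᶠ to y)
    where open Bijection S≅k

module _ {a ℓa : Level} (S : Setoid a ℓa) where

  ≋-uncons : {p : ℕ} → Inverse (≋-setoid S (suc p)) (S ×ₛ ≋-setoid S p)
  ≋-uncons = record
    { to = λ v → v zero , tail v
    ; from = λ { (x , v) → λ { zero → x ; (suc i) → v i } }
    ; to-cong = λ v≋w → v≋w zero , λ i → v≋w (suc i)
    ; from-cong = λ { (x≈y , v≋w) → λ { zero → x≈y ; (suc i) → v≋w i } }
    ; inverse = (λ w≋xv → w≋xv zero , λ i → w≋xv (suc i))
              , (λ { (y≈ , w≋) → λ { zero → y≈ ; (suc i) → w≋ i } })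
    }

  hasCard-≋ : {k : ℕ} → HasCard S k → ∀ p → HasCard (≋-setoid S p) (k ^ p)
  hasCard-≋ S≅k zero = hasCard-1 (≋-setoid S 0) (λ ()) (λ _ _ ())
  hasCard-≋ S≅k (suc p) = hasCard-↔ ≋-uncons (hasCard-× S≅k (hasCard-≋ S≅k p))

module _ {a : Level} {A : Set a} where
  open ≤-Reasoning

  length-middle< : ∀ (xs : List A) y ys z zs → length (y ∷ ys) < length (xs ++ (y ∷ ys) ++ z ∷ zs)
  length-middle< xs y ys z zs = begin-strict
    length (y ∷ ys)                         <⟨ m<m+n (length (y ∷ ys)) (s≤s z≤n) ⟩
    length (y ∷ ys) + length (z ∷ zs)       ≡⟨ length-++ (y ∷ ys) ⟨
    length ((y ∷ ys) ++ z ∷ zs)             ≤⟨ m≤n+m _ (length xs) ⟩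
    length xs + length ((y ∷ ys) ++ z ∷ zs) ≡⟨ length-++ xs ⟨
    length (xs ++ (y ∷ ys) ++ z ∷ zs)       ∎

  length-dropMiddle< : ∀ (xs : List A) y ys zs → length (xs ++ zs) < length (xs ++ (y ∷ ys) ++ zs)
  length-dropMiddle< xs y ys zs = begin-strict
    length (xs ++ zs)                         ≡⟨ length-++ xs ⟩
    length xs + length zs                     <⟨ +-monoʳ-< (length xs) (m<n+m (length zs) (s≤s z≤n)) ⟩
    length xs + (length (y ∷ ys) + length zs) ≡⟨ ≡.cong (length xs +_) (length-++ (y ∷ ys)) ⟨
    length xs + length ((y ∷ ys) ++ zs)       ≡⟨ length-++ xs ⟨
    length (xs ++ (y ∷ ys) ++ zs)             ∎

module _ {n m : ℕ} (Γ : Digraph n m) where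
  open Digraph Γ

  Walk : Set
  Walk = List (Fin n × Dart m)

  private variable
    x y z : Fin n

  opposite : Dart m → Dart m
  opposite (fwd e) = bwd e
  opposite (bwd e) = fwd e

  dfrom-opposite : ∀ d → dfrom Γ (opposite d) ≡ dto Γ d
  dfrom-opposite (fwd e) = ≡.refl
  dfrom-opposite (bwd e) = ≡.refl

  dto-opposite : ∀ d → dto Γ (opposite d) ≡ dfrom Γ d
  dto-opposite (fwd e) = ≡.refl
  dto-opposite (bwd e) = ≡.refl

  _≟ᵈ_ : DecidableEquality (Dart m)
  fwd e ≟ᵈ fwd e′ = map′ (≡.cong fwd) (λ { ≡.refl → ≡.refl }) (e ≟ᶠ e′)
  fwd e ≟ᵈ bwd e′ = no λ ()
  bwd e ≟ᵈ fwd e′ = no λ ()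
  bwd e ≟ᵈ bwd e′ = map′ (≡.cong bwd) (λ { ≡.refl → ≡.refl }) (e ≟ᶠ e′)

  IsWalk-++ : ∀ {ps qs} → IsWalk Γ x y ps → IsWalk Γ y z qs → IsWalk Γ x z (ps ++ qs)
  IsWalk-++ {ps = []} ≡.refl walk = walk
  IsWalk-++ {ps = _ ∷ _} (v≡x , d-from-v , walk) walk′ = v≡x , d-from-v , IsWalk-++ walk walk′

  IsWalk-++⁻ : ∀ ps qs → IsWalk Γ x z (ps ++ qs) → ∃ λ y → IsWalk Γ x y ps × IsWalk Γ y z qs
  IsWalk-++⁻ [] qs walk = _ , ≡.refl , walk
  IsWalk-++⁻ (_ ∷ ps) qs (v≡x , d-from-v , walk) =
    let y , walk₁ , walk₂ = IsWalk-++⁻ ps qs walk in y , (v≡x , d-from-v , walk₁) , walk₂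

  reverseWalk : Walk → Walk
  reverseWalk [] = []
  reverseWalk ((_ , d) ∷ ps) = reverseWalk ps ++ [ dto Γ d , opposite d ]

  IsWalk-reverse : ∀ ps → IsWalk Γ x y ps → IsWalk Γ y x (reverseWalk ps)
  IsWalk-reverse [] ≡.refl = ≡.refl
  IsWalk-reverse ((_ , d) ∷ ps) (≡.refl , ≡.refl , walk) =
    IsWalk-++ (IsWalk-reverse ps walk) (≡.refl , dfrom-opposite d , dto-opposite d)

  IsWalk-transport : ∀ {p} (P : Fin n → Set p) → (∀ d → P (dfrom Γ d) → P (dto Γ d)) →
                     ∀ ps → IsWalk Γ x y ps → P x → P y
  IsWalk-transport P step [] ≡.refl px = px
  IsWalk-transport P step ((_ , d) ∷ ps) (≡.refl , ≡.refl , walk) px =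
    IsWalk-transport P step ps walk (step d px)

  record Repetition (ps : Walk) : Set where
    constructor repetition
    field
      before between after : Walk
      u u′ : Fin n
      d : Dart m
      split : ps ≡ before ++ (u , d) ∷ between ++ (u′ , d) ∷ after

  private
    splitAtDart : ∀ d (ps : Walk) → Any (d ≡_) (map proj₂ ps) →
                  ∃ λ (between : Walk) → ∃ λ u′ → ∃ λ after → ps ≡ between ++ (u′ , d) ∷ after
    splitAtDart d ((u′ , _) ∷ ps) (here ≡.refl) = [] , u′ , ps , ≡.refl
    splitAtDart d (p ∷ ps) (there d∈ps) =
      let between , u′ , after , eq = splitAtDart d ps d∈ps in p ∷ between , u′ , after , ≡.cong (p ∷_) eq

  unique⊎repetition : ∀ (ps : Walk) → Unique (map proj₂ ps) ⊎ Repetition ps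
  unique⊎repetition [] = inj₁ []
  unique⊎repetition ((u , d) ∷ ps) with any? (d ≟ᵈ_) (map proj₂ ps)
  ... | yes d∈ps = let between , u′ , after , eq = splitAtDart d ps d∈ps in
                   inj₂ (repetition [] between after u u′ d (≡.cong ((u , d) ∷_) eq))
  ... | no d∉ps with unique⊎repetition ps
  ...   | inj₁ unique = inj₁ (¬Any⇒All¬ _ d∉ps ∷ unique)
  ...   | inj₂ (repetition before between after u₁ u′ d′ eq) =
            inj₂ (repetition ((u , d) ∷ before) between after u₁ u′ d′ (≡.cong ((u , d) ∷_) eq))

module _ {c ℓ : Level} (G : Group c ℓ) where
  open Group G
  open import Algebra.Properties.Group G
  open import Relation.Binary.Reasoning.Setoid setoid

  twist : Carrier → Carrier → Carrier → Carrier
  twist a x b = a \\ (x ∙ b)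

  twist-cong : ∀ {a a′ x x′ b b′} → a ≈ a′ → x ≈ x′ → b ≈ b′ → twist a x b ≈ twist a′ x′ b′
  twist-cong a≈ x≈ b≈ = \\-cong₂ a≈ (∙-cong x≈ b≈)

  twist-∙ : ∀ a x b y c → twist a x b ∙ twist b y c ≈ twist a (x ∙ y) c
  twist-∙ a x b y c = begin
    (a ⁻¹ ∙ (x ∙ b)) ∙ (b ⁻¹ ∙ (y ∙ c)) ≈⟨ assoc _ _ _ ⟩
    a ⁻¹ ∙ ((x ∙ b) ∙ (b ⁻¹ ∙ (y ∙ c))) ≈⟨ ∙-congˡ (assoc _ _ _) ⟩
    a ⁻¹ ∙ (x ∙ (b ∙ (b ⁻¹ ∙ (y ∙ c)))) ≈⟨ ∙-congˡ (∙-congˡ (\\-leftDividesˡ b (y ∙ c))) ⟩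
    a ⁻¹ ∙ (x ∙ (y ∙ c))               ≈⟨ ∙-congˡ (assoc _ _ _) ⟨
    a ⁻¹ ∙ ((x ∙ y) ∙ c)               ∎

  twist-⁻¹ : ∀ a x b → twist a x b ⁻¹ ≈ twist b (x ⁻¹) a
  twist-⁻¹ a x b = begin
    (a \\ (x ∙ b)) ⁻¹  ≈⟨ ⁻¹-anti-homo-\\ a (x ∙ b) ⟩
    (x ∙ b) ⁻¹ ∙ a     ≈⟨ ∙-congʳ (⁻¹-anti-homo-∙ x b) ⟩
    (b ⁻¹ ∙ x ⁻¹) ∙ a  ≈⟨ assoc _ _ _ ⟩
    b ⁻¹ ∙ (x ⁻¹ ∙ a)  ∎

  twist-injective : ∀ {a x y b} → twist a x b ≈ twist a y b → x ≈ y
  twist-injective {a} {x} {y} {b} eq = ∙-cancelʳ b x y (∙-cancelˡ (a ⁻¹) (x ∙ b) (y ∙ b) eq)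

  twist-ε : ∀ a b → twist a ε b ≈ a \\ b
  twist-ε a b = ∙-congˡ (identityˡ b)

  twist-cancel : ∀ a x b → twist a x a ∙ twist a (x ⁻¹) b ≈ a \\ b
  twist-cancel a x b = begin
    twist a x a ∙ twist a (x ⁻¹) b ≈⟨ twist-∙ a x a (x ⁻¹) b ⟩
    twist a (x ∙ x ⁻¹) b           ≈⟨ twist-cong refl (inverseʳ x) refl ⟩
    twist a ε b                    ≈⟨ twist-ε a b ⟩
    a \\ b                         ∎

  \\-∙-\\ : ∀ a b c → (a \\ b) ∙ (b \\ c) ≈ a \\ c
  \\-∙-\\ a b c = trans (assoc _ _ _) (∙-congˡ (\\-leftDividesˡ b c))

  twist-conjugate : ∀ a x → twist a ((a ∙ x) // a) a ≈ x
  twist-conjugate a x = begin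
    a \\ (((a ∙ x) // a) ∙ a) ≈⟨ ∙-congˡ (//-rightDividesˡ a (a ∙ x)) ⟩
    a \\ (a ∙ x)              ≈⟨ \\-leftDividesʳ a x ⟩
    x                         ∎

  conjugate-twist : ∀ a x → (a ∙ twist a x a) // a ≈ x
  conjugate-twist a x = begin
    (a ∙ (a \\ (x ∙ a))) // a ≈⟨ ∙-congʳ (\\-leftDividesˡ a (x ∙ a)) ⟩
    (x ∙ a) // a              ≈⟨ //-rightDividesʳ a x ⟩
    x                         ∎

  flipIf : Bool → Carrier → Carrier
  flipIf false x = x
  flipIf true x = x ⁻¹

  flipIf-cong : ∀ b {x y} → x ≈ y → flipIf b x ≈ flipIf b y
  flipIf-cong false x≈y = x≈y
  flipIf-cong true x≈y = ⁻¹-cong x≈y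

  flipIf-not : ∀ b x → flipIf (not b) x ≈ flipIf b x ⁻¹
  flipIf-not false x = refl
  flipIf-not true x = sym (⁻¹-involutive x)

  flipIf-involutive : ∀ b x → flipIf b (flipIf b x) ≈ x
  flipIf-involutive false x = refl
  flipIf-involutive true x = ⁻¹-involutive x

module _ {c ℓ : Level} (G : Group c ℓ) {n m : ℕ} (Γ : Digraph n m) where
  open Group G
  open Digraph Γ
  open import Algebra.Properties.Group G
  open import Relation.Binary.Reasoning.Setoid setoid

  private
    π : Fun Γ G → Walk Γ → Carrier
    π = cycleProduct Γ G

    variable
      x y : Fin n

  cycleProduct-++ : ∀ h ps qs → π h (ps ++ qs) ≈ π h ps ∙ π h qs
  cycleProduct-++ h [] qs = sym (identityˡ _)
  cycleProduct-++ h ((v , d) ∷ ps) qs = begin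
    h (inj₁ v) ∙ (h (inj₂ d) ∙ π h (ps ++ qs))     ≈⟨ ∙-congˡ (∙-congˡ (cycleProduct-++ h ps qs)) ⟩
    h (inj₁ v) ∙ (h (inj₂ d) ∙ (π h ps ∙ π h qs))  ≈⟨ ∙-congˡ (assoc _ _ _) ⟨
    h (inj₁ v) ∙ ((h (inj₂ d) ∙ π h ps) ∙ π h qs)  ≈⟨ assoc _ _ _ ⟨
    (h (inj₁ v) ∙ (h (inj₂ d) ∙ π h ps)) ∙ π h qs  ∎

  cycleProduct-cong : ∀ {h h′} → (∀ u → h u ≈ h′ u) → ∀ ps → π h ps ≈ π h′ ps
  cycleProduct-cong h≈h′ [] = refl
  cycleProduct-cong h≈h′ ((v , d) ∷ ps) =
    ∙-cong (h≈h′ (inj₁ v)) (∙-cong (h≈h′ (inj₂ d)) (cycleProduct-cong h≈h′ ps))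

  module _ {h : Fun Γ G} (balanced : Balanced Γ G h) where

    -- A closed walk that repeats a dart splits into two shorter closed walks.
    private
      closedWalk-product′ : ∀ ps → Acc _<_ (length ps) → IsWalk Γ x x ps → π h ps ≈ ε
      closedWalk-product′ {x} ps (acc shorter) walk with unique⊎repetition Γ ps
      ... | inj₁ unique = proj₂ balanced x ps (walk , unique)
      ... | inj₂ (repetition before between after u u′ d ≡.refl)
        with IsWalk-++⁻ Γ before ((u , d) ∷ between ++ (u′ , d) ∷ after) walk
      ... | _ , walk₁ , (≡.refl , ≡.refl , walk₂)
        with IsWalk-++⁻ Γ between ((u′ , d) ∷ after) walk₂
      ... | _ , walk₃ , (≡.refl , ≡.refl , walk₄) = begin
        π h (before ++ cycle ++ rest)          ≈⟨ cycleProduct-++ h before (cycle ++ rest) ⟩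
        π h before ∙ π h (cycle ++ rest)       ≈⟨ ∙-congˡ (cycleProduct-++ h cycle rest) ⟩
        π h before ∙ (π h cycle ∙ π h rest)    ≈⟨ ∙-congˡ (∙-congʳ cycle≈ε) ⟩
        π h before ∙ (ε ∙ π h rest)            ≈⟨ ∙-congˡ (identityˡ _) ⟩
        π h before ∙ π h rest                  ≈⟨ cycleProduct-++ h before rest ⟨
        π h (before ++ rest)                   ≈⟨ remainder≈ε ⟩
        ε                                      ∎
        where
        cycle rest : Walk Γ
        cycle = (dfrom Γ d , d) ∷ between
        rest = (dfrom Γ d , d) ∷ after
        cycle≈ε : π h cycle ≈ ε
        cycle≈ε = closedWalk-product′ cycle
          (shorter (length-middle< before _ between _ after)) (≡.refl , ≡.refl , walk₃)
        remainder≈ε : π h (before ++ rest) ≈ ε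
        remainder≈ε = closedWalk-product′ (before ++ rest)
          (shorter (length-dropMiddle< before _ between rest)) (IsWalk-++ Γ walk₁ (≡.refl , ≡.refl , walk₄))

    closedWalk-product : ∀ ps → IsWalk Γ x x ps → π h ps ≈ ε
    closedWalk-product ps = closedWalk-product′ ps (<-wellFounded (length ps))

    walk-product-unique : ∀ ps qs → IsWalk Γ x y ps → IsWalk Γ x y qs → π h ps ≈ π h qs
    walk-product-unique {x} {y} ps qs walk walk′ =
      trans (inverseˡ-unique _ _ (ps∙back≈ε ps walk)) (sym (inverseˡ-unique _ _ (ps∙back≈ε qs walk′)))
      where
      back : Walk Γ
      back = reverseWalk Γ qs
      ps∙back≈ε : ∀ ps → IsWalk Γ x y ps → π h ps ∙ π h back ≈ ε
      ps∙back≈ε ps walk = trans (sym (cycleProduct-++ h ps back))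
        (closedWalk-product (ps ++ back) (IsWalk-++ Γ walk (IsWalk-reverse Γ qs walk′)))

  Alternating : (Fin n → Carrier) → Set ℓ
  Alternating z = ∀ e → z (tgt e) ≈ z (src e) ⁻¹

  alternatingSetoid : Setoid (c ⊔ ℓ) ℓ
  alternatingSetoid = On.setoid {B = Σ (Fin n → Carrier) Alternating} (≋-setoid setoid n) proj₁

  alternating-dart : ∀ {z} → Alternating z → ∀ d → z (dto Γ d) ≈ z (dfrom Γ d) ⁻¹
  alternating-dart alt (fwd e) = alt e
  alternating-dart alt (bwd e) = trans (sym (⁻¹-involutive _)) (⁻¹-cong (sym (alt e)))

  assemble : (Fin n → Carrier) → (Fin n → Carrier) → Fun Γ G
  assemble z q (inj₁ v) = twist G (q v) (z v) (q v)
  assemble z q (inj₂ d) = twist G (q (dfrom Γ d)) (z (dfrom Γ d) ⁻¹) (q (dto Γ d))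

  assemble-cong : ∀ {z z′ q q′} → (∀ v → z v ≈ z′ v) → (∀ v → q v ≈ q′ v) →
                  ∀ u → assemble z q u ≈ assemble z′ q′ u
  assemble-cong z≈ q≈ (inj₁ v) = twist-cong G (q≈ v) (z≈ v) (q≈ v)
  assemble-cong z≈ q≈ (inj₂ d) = twist-cong G (q≈ (dfrom Γ d)) (⁻¹-cong (z≈ (dfrom Γ d))) (q≈ (dto Γ d))

  cycleProduct-assemble : ∀ z q ps → IsWalk Γ x y ps → π (assemble z q) ps ≈ q x \\ q y
  cycleProduct-assemble z q [] ≡.refl = sym (inverseˡ _)
  cycleProduct-assemble {y = y} z q ((_ , d) ∷ ps) (≡.refl , ≡.refl , walk) = begin
    h (inj₁ v) ∙ (h (inj₂ d) ∙ π h ps)     ≈⟨ assoc _ _ _ ⟨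
    (h (inj₁ v) ∙ h (inj₂ d)) ∙ π h ps     ≈⟨ ∙-cong (twist-cancel G (q v) (z v) (q w)) (cycleProduct-assemble z q ps walk) ⟩
    (q v \\ q w) ∙ (q w \\ q y)            ≈⟨ \\-∙-\\ G (q v) (q w) (q y) ⟩
    q v \\ q y                             ∎
    where
    h : Fun Γ G
    h = assemble z q
    v w : Fin n
    v = dfrom Γ d
    w = dto Γ d

  assemble-balanced : ∀ {z} → Alternating z → ∀ q → Balanced Γ G (assemble z q)
  assemble-balanced {z} alt q = reverse-inverse , cycle-trivial
    where
    reverse-inverse : ∀ e → assemble z q (inj₂ (bwd e)) ≈ assemble z q (inj₂ (fwd e)) ⁻¹
    reverse-inverse e = begin
      twist G (q (tgt e)) (z (tgt e) ⁻¹) (q (src e))       ≈⟨ twist-cong G refl (⁻¹-cong (alt e)) refl ⟩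
      twist G (q (tgt e)) (z (src e) ⁻¹ ⁻¹) (q (src e))    ≈⟨ twist-⁻¹ G (q (src e)) (z (src e) ⁻¹) (q (tgt e)) ⟨
      twist G (q (src e)) (z (src e) ⁻¹) (q (tgt e)) ⁻¹    ∎
    cycle-trivial : ∀ x ps → IsCycle Γ x ps → π (assemble z q) ps ≈ ε
    cycle-trivial x ps (walk , _) = trans (cycleProduct-assemble z q ps walk) (inverseˡ (q x))

  module Potential (connected : WeaklyConnected Γ) (r : Fin n) {h : Fun Γ G} (balanced : Balanced Γ G h) where

    potential : Fin n → Carrier
    potential v = π h (proj₁ (connected r v))

    potential-root : potential r ≈ ε
    potential-root = closedWalk-product {h = h} balanced _ (proj₂ (connected r r))

    potential-step : ∀ d → h (inj₁ (dfrom Γ d)) ∙ h (inj₂ d) ≈ potential (dfrom Γ d) \\ potential (dto Γ d)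
    potential-step d = y≈x\\z _ _ _ (begin
      potential v ∙ (h (inj₁ v) ∙ h (inj₂ d))          ≈⟨ ∙-congˡ (∙-congˡ (identityʳ _)) ⟨
      π h (proj₁ (connected r v)) ∙ π h [ v , d ]      ≈⟨ cycleProduct-++ h (proj₁ (connected r v)) [ v , d ] ⟨
      π h (proj₁ (connected r v) ++ [ v , d ])         ≈⟨ walk-product-unique {h = h} balanced _ _ extended (proj₂ (connected r w)) ⟩
      potential w                                      ∎)
      where
      v w : Fin n
      v = dfrom Γ d
      w = dto Γ d
      extended : IsWalk Γ r w (proj₁ (connected r v) ++ [ v , d ])
      extended = IsWalk-++ Γ (proj₂ (connected r v)) (≡.refl , ≡.refl , ≡.refl)

    gaugedValue : Fin n → Carrier
    gaugedValue v = (potential v ∙ h (inj₁ v)) // potential v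

    vertex-twist : ∀ v → h (inj₁ v) ≈ twist G (potential v) (gaugedValue v) (potential v)
    vertex-twist v = sym (twist-conjugate G (potential v) (h (inj₁ v)))

    dart-twist : ∀ d → h (inj₂ d) ≈ twist G (potential (dfrom Γ d)) (gaugedValue (dfrom Γ d) ⁻¹) (potential (dto Γ d))
    dart-twist d = ∙-cancelˡ (h (inj₁ v)) _ _ (begin
      h (inj₁ v) ∙ h (inj₂ d)                                 ≈⟨ potential-step d ⟩
      potential v \\ potential w                              ≈⟨ twist-cancel G (potential v) (gaugedValue v) (potential w) ⟨
      twist G (potential v) (gaugedValue v) (potential v)
        ∙ twist G (potential v) (gaugedValue v ⁻¹) (potential w) ≈⟨ ∙-congʳ (vertex-twist v) ⟨
      h (inj₁ v) ∙ twist G (potential v) (gaugedValue v ⁻¹) (potential w) ∎)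
      where
      v w : Fin n
      v = dfrom Γ d
      w = dto Γ d

    gaugedValue-alternating : Alternating gaugedValue
    gaugedValue-alternating e = ⁻¹-injective (twist-injective G (begin
      twist G (potential t) (gaugedValue t ⁻¹) (potential s)       ≈⟨ dart-twist (bwd e) ⟨
      h (inj₂ (bwd e))                                             ≈⟨ proj₁ balanced e ⟩
      h (inj₂ (fwd e)) ⁻¹                                          ≈⟨ ⁻¹-cong (dart-twist (fwd e)) ⟩
      twist G (potential s) (gaugedValue s ⁻¹) (potential t) ⁻¹    ≈⟨ twist-⁻¹ G (potential s) _ (potential t) ⟩
      twist G (potential t) (gaugedValue s ⁻¹ ⁻¹) (potential s)    ∎))
      where
      s t : Fin n
      s = src e
      t = tgt e

    assemble-gaugedValue : ∀ u → assemble gaugedValue potential u ≈ h u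
    assemble-gaugedValue (inj₁ v) = sym (vertex-twist v)
    assemble-gaugedValue (inj₂ d) = sym (dart-twist d)

  module _ (connected : WeaklyConnected Γ) (r : Fin n) where

    private
      transport : ∀ {p} (P : Fin n → Set p) → (∀ d → P (dfrom Γ d) → P (dto Γ d)) → P r → ∀ v → P v
      transport P step Pr v = IsWalk-transport Γ P step (proj₁ (connected r v)) (proj₂ (connected r v)) Pr

    alternating-unique : ∀ {z z′} → Alternating z → Alternating z′ → z r ≈ z′ r → ∀ v → z v ≈ z′ v
    alternating-unique {z} {z′} alt alt′ = transport (λ v → z v ≈ z′ v) λ d z≈z′ →
      trans (alternating-dart {z} alt d) (trans (⁻¹-cong z≈z′) (sym (alternating-dart {z′} alt′ d)))

    alternating-values : ∀ {z} → Alternating z → ∀ v → z v ≈ z r ⊎ z v ≈ z r ⁻¹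
    alternating-values {z} alt = transport (λ v → z v ≈ z r ⊎ z v ≈ z r ⁻¹) step (inj₁ refl)
      where
      step : ∀ d → z (dfrom Γ d) ≈ z r ⊎ z (dfrom Γ d) ≈ z r ⁻¹ → z (dto Γ d) ≈ z r ⊎ z (dto Γ d) ≈ z r ⁻¹
      step d (inj₁ eq) = inj₂ (trans (alternating-dart {z} alt d) (⁻¹-cong eq))
      step d (inj₂ eq) = inj₁ (trans (alternating-dart {z} alt d) (trans (⁻¹-cong eq) (⁻¹-involutive _)))

    -- If z r ≉ z r ⁻¹, colouring each vertex by whether z takes the value z r there is a proper 2-colouring.
    nonBipartite⇒selfInverse : Decidable _≈_ → ¬ Bipartite Γ → ∀ {z} → Alternating z → z r ≈ z r ⁻¹
    nonBipartite⇒selfInverse _≟_ nonBipartite {z} alt =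
      decidable-stable (a ≟ (a ⁻¹)) λ a≉a⁻¹ → nonBipartite (colour , proper a≉a⁻¹)
      where
      a : Carrier
      a = z r
      colour : Fin n → Bool
      colour v = does (z v ≟ a)
      proper : ¬ a ≈ a ⁻¹ → ∀ e → colour (src e) ≢ colour (tgt e)
      proper a≉a⁻¹ e with z (src e) ≟ a | z (tgt e) ≟ a
      ... | yes s≈a | yes t≈a = λ _ → a≉a⁻¹ (trans (sym t≈a) (trans (alt e) (⁻¹-cong s≈a)))
      ... | yes _   | no _    = λ ()
      ... | no _    | yes _   = λ ()
      ... | no s≉a  | no t≉a  = λ _ → t≉a (trans (alt e) (trans (⁻¹-cong s≈a⁻¹) (⁻¹-involutive a)))
        where
        s≈a⁻¹ : z (src e) ≈ a ⁻¹
        s≈a⁻¹ with alternating-values {z} alt (src e)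
        ... | inj₁ s≈a = contradiction s≈a s≉a
        ... | inj₂ s≈a⁻¹ = s≈a⁻¹

    alternating↔carrier : Bipartite Γ → Inverse alternatingSetoid setoid
    alternating↔carrier (colour , proper) =
      mkInverse (λ z → proj₁ z r) (λ x → fromRoot x , fromRoot-alternating x)
        (λ z≋z′ → z≋z′ r) (λ x≈y v → flipIf-cong G (colour v) (flipIf-cong G (colour r) x≈y))
        (λ x → flipIf-involutive G (colour r) x)
        (λ (z , alt) → alternating-unique (fromRoot-alternating (z r)) alt (flipIf-involutive G (colour r) (z r)))
      where
      fromRoot : Carrier → Fin n → Carrier
      fromRoot x v = flipIf G (colour v) (flipIf G (colour r) x)
      fromRoot-alternating : ∀ x → Alternating (fromRoot x)
      fromRoot-alternating x e rewrite ¬-not (proper e ∘ ≡.sym) = flipIf-not G (colour (src e)) _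

    alternating↔involutions : Decidable _≈_ → ¬ Bipartite Γ → Inverse alternatingSetoid (G₂ G)
    alternating↔involutions _≟_ nonBipartite =
      mkInverse (λ (z , alt) → z r , selfInverse⇒square (nonBipartite⇒selfInverse _≟_ nonBipartite alt))
        (λ (x , x²≈ε) → (λ _ → x) , λ _ → square⇒selfInverse x²≈ε)
        (λ z≋z′ → z≋z′ r) (λ x≈y _ → x≈y)
        (λ _ → refl)
        (λ (z , alt) → alternating-unique (λ _ → nonBipartite⇒selfInverse _≟_ nonBipartite alt) alt refl)
      where
      selfInverse⇒square : ∀ {x} → x ≈ x ⁻¹ → x ∙ x ≈ ε
      selfInverse⇒square {x} x≈x⁻¹ = trans (∙-congˡ x≈x⁻¹) (inverseʳ x)
      square⇒selfInverse : ∀ {x} → x ∙ x ≈ ε → x ≈ x ⁻¹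
      square⇒selfInverse {x} = inverseˡ-unique x x

module _ {c ℓ : Level} (G : Group c ℓ) {n′ m : ℕ} (Γ : Digraph (suc n′) m) (connected : WeaklyConnected Γ) where
  open Group G
  open import Algebra.Properties.Group G
  open import Relation.Binary.Reasoning.Setoid setoid
  private
    module Pot (hb : Setoid.Carrier (FU Γ G)) = Potential G Γ connected zero {proj₁ hb} (proj₂ hb)

  rooted : (Fin n′ → Carrier) → Fin (suc n′) → Carrier
  rooted q zero = ε
  rooted q (suc i) = q i

  private
    module FU = Setoid (FU Γ G)
    module D = Setoid (alternatingSetoid G Γ ×ₛ ≋-setoid setoid n′)

  assembleRooted : D.Carrier → FU.Carrier
  assembleRooted ((z , alt) , q) = assemble G Γ z (rooted q) , assemble-balanced G Γ alt (rooted q)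

  potential-assembleRooted : ∀ zq v → Pot.potential (assembleRooted zq) v ≈ rooted (proj₂ zq) v
  potential-assembleRooted ((z , _) , q) v = begin
    cycleProduct Γ G (assemble G Γ z (rooted q)) (proj₁ (connected zero v))
      ≈⟨ cycleProduct-assemble G Γ z (rooted q) _ (proj₂ (connected zero v)) ⟩
    ε \\ rooted q v ≈⟨ trans (∙-congʳ ε⁻¹≈ε) (identityˡ _) ⟩
    rooted q v ∎

  gaugeDecomposition : Inverse (FU Γ G) (alternatingSetoid G Γ ×ₛ ≋-setoid setoid n′)
  gaugeDecomposition = mkInverse decompose assembleRooted (λ {x} {y} → decompose-cong {x} {y}) (λ {x} {y} → assembleRooted-cong {x} {y})
    decompose∘assembleRooted assembleRooted∘decompose
    where
    decompose : FU.Carrier → D.Carrier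
    decompose hb = (gaugedValue , gaugedValue-alternating) , tail potential
      where open Pot hb
    decompose-cong : Congruent FU._≈_ D._≈_ decompose
    decompose-cong {h , bal} {h′ , bal′} h≈h′ =
      (λ v → //-cong₂ (∙-cong (P≈P′ v) (h≈h′ (inj₁ v))) (P≈P′ v)) , λ i → P≈P′ (suc i)
      where
      P≈P′ : ∀ v → Pot.potential (h , bal) v ≈ Pot.potential (h′ , bal′) v
      P≈P′ v = cycleProduct-cong G Γ h≈h′ (proj₁ (connected zero v))
    assembleRooted-cong : Congruent D._≈_ FU._≈_ assembleRooted
    assembleRooted-cong (z≋z′ , q≋q′) = assemble-cong G Γ z≋z′ λ { zero → refl ; (suc i) → q≋q′ i }
    decompose∘assembleRooted : StrictlyInverseˡ D._≈_ decompose assembleRooted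
    decompose∘assembleRooted zq@((z , _) , q) =
      (λ v → trans (//-cong₂ (∙-congʳ (P≈q v)) (P≈q v)) (conjugate-twist G (rooted q v) (z v)))
      , λ i → P≈q (suc i)
      where P≈q = potential-assembleRooted zq
    assembleRooted∘decompose : StrictlyInverseʳ FU._≈_ decompose assembleRooted
    assembleRooted∘decompose hb u = trans (assemble-cong G Γ (λ _ → refl) rooted-tail u) (assemble-gaugedValue u)
      where
      open Pot hb
      rooted-tail : ∀ v → rooted (tail potential) v ≈ potential v
      rooted-tail zero = sym potential-root
      rooted-tail (suc i) = refl

module _ {m : ℕ} (Γ : Digraph 0 m) where
  open Digraph Γ

  emptyGraph-bipartite : Bipartite Γ
  emptyGraph-bipartite = (λ ()) , λ e → ⊥-elim (¬Fin0 (src e))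

  emptyGraph-hasCard : {c ℓ : Level} (G : Group c ℓ) → HasCard (FU Γ G) 1
  emptyGraph-hasCard G = hasCard-1 (FU Γ G) (trivial , (λ e → ⊥-elim (¬Fin0 (src e))) , λ ())
    λ { _ _ (inj₁ ()) ; _ _ (inj₂ d) → ⊥-elim (¬Fin0 (dfrom Γ d)) }
    where
    trivial : Fun Γ G
    trivial (inj₁ ())
    trivial (inj₂ d) = ⊥-elim (¬Fin0 (dfrom Γ d))

mainTheorem1 : {c ℓ : Level} (G : Group c ℓ) (k k₂ : ℕ) →
    HasCard (Group.setoid G) k → HasCard (G₂ G) k₂ →
    {n m : ℕ} (Γ : Digraph n m) → WeaklyConnected Γ →
    (Bipartite Γ → HasCard (FU Γ G) (k ^ n))
    × (¬ Bipartite Γ → HasCard (FU Γ G) (k₂ * k ^ (n ∸ 1)))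
mainTheorem1 G k k₂ G≅k G₂≅k₂ {zero} Γ _ =
  (λ _ → emptyGraph-hasCard Γ G) , contradiction (emptyGraph-bipartite Γ)
mainTheorem1 G k k₂ G≅k G₂≅k₂ {suc n′} Γ connected =
    (λ bipartite → count (alternating↔carrier G Γ connected zero bipartite) G≅k)
  , (λ nonBipartite → count (alternating↔involutions G Γ connected zero (hasCard⇒decidable (Group.setoid G) G≅k) nonBipartite) G₂≅k₂)
  where
  count : ∀ {a ℓa} {S : Setoid a ℓa} {j} → Inverse (alternatingSetoid G Γ) S → HasCard S j →
          HasCard (FU Γ G) (j * k ^ n′)
  count alternating↔S S≅j = hasCard-↔ (gaugeDecomposition G Γ connected)
    (hasCard-× (hasCard-↔ alternating↔S S≅j) (hasCard-≋ (Group.setoid G) G≅k n′))
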